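{- Let $h\geq 5$ be an integer and let $A=\{0,1,2,3,\ldots,h-1,h+1\}$ (that is, $[0,h+1]\setminus\{h\}$). Then $|h^{\wedge}_{\pm}A|\geq h^2+h+3$.
   Context: For a finite set $A=\{a_1,\ldots,a_k\}$ of integers and a positive integer $h$, the restricted $h$-fold signed sumset is $h^{\wedge}_{\pm}A=\left\{\sum_{i=1}^{k}\lambda_i a_i : \lambda_i\in\{ -1,0,1\} \text{ for all } i,\ \sum_{i=1}^{k}|\lambda_i| = h\right\}$. For integers $a\le b$, $[a,b]=\{n\in\mathbb{Z}: a\le n\le b\}$. -}

module Defs where

open import Data.Nat as ℕ using (ℕ; zero; suc)
open import Data.Integer as ℤ using (ℤ; +_)
open import Data.List using (List; []; _∷_; length; map; upTo; _++_)
open import Data.Product using (Σ; _×_; _,_)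
open import Relation.Binary.PropositionalEquality using (_≡_)

data Sign : Set where
  neg zer pos : Sign

absS : Sign → ℕ
absS neg = 1
absS zer = 0
absS pos = 1

actS : Sign → ℤ → ℤ
actS neg a = ℤ.- a
actS zer a = + 0
actS pos a = a

-- A coefficient assignment λ for the list of elements a₁,…,a_k,
-- with Σ|λᵢ| = h and Σ λᵢ aᵢ = n.
data Rep : List ℤ → ℕ → ℤ → Set where
  rep-nil  : Rep [] 0 (+ 0)
  rep-cons : ∀ {as h n} (s : Sign) (a : ℤ) →
             Rep as h n → Rep (a ∷ as) (absS s ℕ.+ h) (actS s a ℤ.+ n)

-- n ∈ h^∧_± A, where A is given as a list of its (distinct) elements
_∈SignedSumset_ : ℤ → (ℕ × List ℤ) → Set
n ∈SignedSumset (h , A) = Rep A h n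

setA : ℕ → List ℤ
setA h = map +_ (upTo h) ++ (+ (suc h) ∷ [])

-- With T(h) = 0 + 1 + ⋯ + (h-1), the whole interval [-(T(h) + h + 1), T(h) + h + 1], of size
-- h² + h + 3, lies in h^∧_± A. Say a list covers [-T, T] with c terms if it represents every
-- integer there with exactly c nonzero signs. Appending a new element a ≤ T, with sign -1 for
-- the lower part and +1 for the upper part, covers [-(T + a), T + a] with c + 1 terms.
-- {0,1,2,3} covers [-6, 6] with 3 terms; appending 4, …, h-1 and finally h + 1 is possible
-- since h + 1 ≤ T(h) for h ≥ 4.
module Submission where

open import Defs
open import Data.Nat using (ℕ; zero; suc; _≤_; _<_; _+_; _*_; _∸_; _≤?_; s≤s; s≤s⁻¹; z≤n)
import Data.Nat.Properties as ℕ
import Data.Nat.Tactic.RingSolver as ℕ-Ring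
open import Data.Integer using (ℤ; +_)
import Data.Integer as ℤ
import Data.Integer.Properties as ℤ
open import Data.Integer.Tactic.RingSolver using (solve-∀)
open import Algebra.Properties.AbelianGroup ℤ.+-0-abelianGroup using (∙-cancelʳ)
open import Data.List using (List; []; _∷_; _++_; _∷ʳ_; length; map; upTo)
import Data.List.Properties as List
open import Data.List.Relation.Unary.All using (All)
import Data.List.Relation.Unary.All as All
import Data.List.Relation.Unary.All.Properties as All
open import Data.List.Relation.Unary.Unique.Propositional using (Unique)
import Data.List.Relation.Unary.Unique.Propositional.Properties as Unique
open import Data.List.Membership.Propositional.Properties using (∈-upTo⁻)
open import Data.Product using (Σ; ∃-syntax; _×_; _,_)
open import Data.Sum using (_⊎_; inj₁; inj₂)
open import Function using (_∘_)
open import Relation.Binary.PropositionalEquality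
open import Relation.Nullary using (yes; no)

Rep-++ : ∀ {xs ys c d m n} → Rep xs c m → Rep ys d n → Rep (xs ++ ys) (c + d) (m ℤ.+ n)
Rep-++ rep-nil r = subst (Rep _ _) (sym (ℤ.+-identityˡ _)) r
Rep-++ (rep-cons s a r) r′ =
  subst₂ (Rep _) (sym (ℕ.+-assoc (absS s) _ _)) (sym (ℤ.+-assoc (actS s a) _ _))
    (rep-cons s a (Rep-++ r r′))

Rep-∷ʳ : ∀ {xs c n} → Rep xs c n → ∀ s a → Rep (xs ∷ʳ a) (absS s + c) (n ℤ.+ actS s a)
Rep-∷ʳ {xs} {c} {n} r s a =
  subst₂ (Rep (xs ∷ʳ a))
    (trans (cong (_+_ c) (ℕ.+-identityʳ (absS s))) (ℕ.+-comm c (absS s)))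
    (cong (ℤ._+_ n) (ℤ.+-identityʳ (actS s a)))
    (Rep-++ r (rep-cons s a rep-nil))

-- [-T, T] is indexed by i ∈ [0, 2T] as i - T, so that case analysis happens in ℕ.
Covers : List ℤ → ℕ → ℕ → Set
Covers xs c T = ∀ i → i ≤ T + T → Rep xs c (+ i ℤ.- + T)

index-split : ∀ {T m i} → m ≤ T → i ≤ (T + m) + (T + m) →
              i ≤ T + T ⊎ ∃[ j ] j ≤ T + T × i ≡ (m + m) + j
index-split {T} {m} {i} m≤T i≤ with i ≤? T + T
... | yes i≤2T = inj₁ i≤2T
... | no i≰2T = inj₂ (i ∸ (m + m) , j≤2T , sym (ℕ.m+[n∸m]≡n 2m≤i))
  where
  2m≤i : m + m ≤ i
  2m≤i = ℕ.≤-trans (ℕ.+-mono-≤ m≤T m≤T) (ℕ.<⇒≤ (ℕ.≰⇒> i≰2T))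
  j≤2T : i ∸ (m + m) ≤ T + T
  j≤2T = ℕ.+-cancelˡ-≤ (m + m) _ _ (begin
    (m + m) + (i ∸ (m + m)) ≡⟨ ℕ.m+[n∸m]≡n 2m≤i ⟩
    i                       ≤⟨ i≤ ⟩
    (T + m) + (T + m)       ≡⟨ ℕ-Ring.solve (T ∷ m ∷ []) ⟩
    (m + m) + (T + T)       ∎)
    where open ℕ.≤-Reasoning

Covers-∷ʳ : ∀ {xs c T m} → m ≤ T → Covers xs c T → Covers (xs ∷ʳ + m) (suc c) (T + m)
Covers-∷ʳ {T = T} {m} m≤T cov i i≤ with index-split m≤T i≤
... | inj₁ i≤2T = subst (Rep _ _) lower (Rep-∷ʳ (cov i i≤2T) neg (+ m))
  where
  lower : (+ i ℤ.- + T) ℤ.+ ℤ.- + m ≡ + i ℤ.- + (T + m)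
  lower = begin
    (+ i ℤ.- + T) ℤ.+ ℤ.- + m  ≡⟨ shuffle (+ i) (+ T) (+ m) ⟩
    + i ℤ.- (+ T ℤ.+ + m)      ≡⟨ cong (ℤ._-_ (+ i)) (ℤ.pos-+ T m) ⟨
    + i ℤ.- + (T + m)          ∎
    where
    open ≡-Reasoning
    shuffle : ∀ x t y → (x ℤ.- t) ℤ.+ ℤ.- y ≡ x ℤ.- (t ℤ.+ y)
    shuffle = solve-∀
... | inj₂ (j , j≤2T , refl) = subst (Rep _ _) upper (Rep-∷ʳ (cov j j≤2T) pos (+ m))
  where
  upper : (+ j ℤ.- + T) ℤ.+ + m ≡ + ((m + m) + j) ℤ.- + (T + m)
  upper = begin
    (+ j ℤ.- + T) ℤ.+ + m                ≡⟨ shuffle (+ j) (+ T) (+ m) ⟩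
    ((+ m ℤ.+ + m) ℤ.+ + j) ℤ.- (+ T ℤ.+ + m)
      ≡⟨ cong₂ (λ x y → (x ℤ.+ + j) ℤ.- y) (ℤ.pos-+ m m) (ℤ.pos-+ T m) ⟨
    (+ (m + m) ℤ.+ + j) ℤ.- + (T + m)    ≡⟨ cong (λ x → x ℤ.- + (T + m)) (ℤ.pos-+ (m + m) j) ⟨
    + ((m + m) + j) ℤ.- + (T + m)        ∎
    where
    open ≡-Reasoning
    shuffle : ∀ x t y → (x ℤ.- t) ℤ.+ y ≡ ((y ℤ.+ y) ℤ.+ x) ℤ.- (t ℤ.+ y)
    shuffle = solve-∀

Covers⇒distinct : ∀ {xs c T} → Covers xs c T →
  Σ (List ℤ) (λ L → Unique L × All (Rep xs c) L × suc (T + T) ≤ length L)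
Covers⇒distinct {T = T} cov =
  map centred (upTo (suc (T + T))) ,
  Unique.map⁺ centred-injective (Unique.upTo⁺ _) ,
  All.map⁺ (All.tabulate (λ {i} i∈ → cov i (s≤s⁻¹ (∈-upTo⁻ i∈)))) ,
  ℕ.≤-reflexive (sym (trans (List.length-map centred (upTo (suc (T + T)))) (List.length-upTo _)))
  where
  centred : ℕ → ℤ
  centred i = + i ℤ.- + T
  centred-injective : ∀ {i j} → centred i ≡ centred j → i ≡ j
  centred-injective = ℤ.+-injective ∘ ∙-cancelʳ (ℤ.- + T) _ _

covers-upTo-4 : Covers (map +_ (upTo 4)) 3 6
covers-upTo-4 0 _ = rep-cons zer _ (rep-cons neg _ (rep-cons neg _ (rep-cons neg _ rep-nil)))
covers-upTo-4 1 _ = rep-cons pos _ (rep-cons zer _ (rep-cons neg _ (rep-cons neg _ rep-nil)))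
covers-upTo-4 2 _ = rep-cons zer _ (rep-cons pos _ (rep-cons neg _ (rep-cons neg _ rep-nil)))
covers-upTo-4 3 _ = rep-cons pos _ (rep-cons neg _ (rep-cons neg _ (rep-cons zer _ rep-nil)))
covers-upTo-4 4 _ = rep-cons zer _ (rep-cons neg _ (rep-cons pos _ (rep-cons neg _ rep-nil)))
covers-upTo-4 5 _ = rep-cons pos _ (rep-cons pos _ (rep-cons neg _ (rep-cons zer _ rep-nil)))
covers-upTo-4 6 _ = rep-cons zer _ (rep-cons pos _ (rep-cons pos _ (rep-cons neg _ rep-nil)))
covers-upTo-4 7 _ = rep-cons pos _ (rep-cons neg _ (rep-cons pos _ (rep-cons zer _ rep-nil)))
covers-upTo-4 8 _ = rep-cons zer _ (rep-cons pos _ (rep-cons neg _ (rep-cons pos _ rep-nil)))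
covers-upTo-4 9 _ = rep-cons pos _ (rep-cons pos _ (rep-cons pos _ (rep-cons zer _ rep-nil)))
covers-upTo-4 10 _ = rep-cons zer _ (rep-cons neg _ (rep-cons pos _ (rep-cons pos _ rep-nil)))
covers-upTo-4 11 _ = rep-cons pos _ (rep-cons zer _ (rep-cons pos _ (rep-cons pos _ rep-nil)))
covers-upTo-4 12 _ = rep-cons zer _ (rep-cons pos _ (rep-cons pos _ (rep-cons pos _ rep-nil)))
covers-upTo-4 (suc (suc (suc (suc (suc (suc (suc (suc (suc (suc (suc (suc (suc _)))))))))))))
  (s≤s (s≤s (s≤s (s≤s (s≤s (s≤s (s≤s (s≤s (s≤s (s≤s (s≤s (s≤s ()))))))))))))

tri : ℕ → ℕ
tri zero = 0
tri (suc n) = tri n + n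

tri+tri+n≡n*n : ∀ n → tri n + tri n + n ≡ n * n
tri+tri+n≡n*n zero = refl
tri+tri+n≡n*n (suc n) = begin
  (tri n + n) + (tri n + n) + suc n ≡⟨ shuffle (tri n) n ⟩
  (tri n + tri n + n) + suc (n + n) ≡⟨ cong (_+ suc (n + n)) (tri+tri+n≡n*n n) ⟩
  n * n + suc (n + n)               ≡⟨ ℕ-Ring.solve (n ∷ []) ⟩
  suc n * suc n                     ∎
  where
  open ≡-Reasoning
  shuffle : ∀ t n → (t + n) + (t + n) + suc n ≡ (t + t + n) + suc (n + n)
  shuffle = ℕ-Ring.solve-∀

4+k<tri[4+k] : ∀ k → 4 + k < tri (4 + k)
4+k<tri[4+k] zero = ℕ.m≤m+n 5 1
4+k<tri[4+k] (suc k) =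
  subst (_< tri (4 + k) + (4 + k)) (ℕ.+-comm (4 + k) 1)
    (ℕ.+-mono-<-≤ (4+k<tri[4+k] k) (s≤s z≤n))

covers-upTo : ∀ k → Covers (map +_ (upTo (4 + k))) (3 + k) (tri (4 + k))
covers-upTo zero = covers-upTo-4
covers-upTo (suc k) =
  subst (λ xs → Covers xs (4 + k) (tri (5 + k))) (sym map-upTo-suc)
    (Covers-∷ʳ (ℕ.<⇒≤ (4+k<tri[4+k] k)) (covers-upTo k))
  where
  map-upTo-suc : map +_ (upTo (5 + k)) ≡ map +_ (upTo (4 + k)) ∷ʳ + (4 + k)
  map-upTo-suc = trans (cong (λ ns → map +_ ns) (sym (List.upTo-∷ʳ (4 + k))))
                       (List.map-++ (λ n → + n) (upTo (4 + k)) _)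

covers-setA : ∀ k → Covers (setA (4 + k)) (4 + k) (tri (4 + k) + (5 + k))
covers-setA k = Covers-∷ʳ (4+k<tri[4+k] k) (covers-upTo k)

lemma2p17 : (h : ℕ) → 5 ≤ h →
    Σ (List ℤ) (λ L → Unique L × All (λ n → n ∈SignedSumset (h , setA h)) L
    × (h * h + h + 3 ≤ length L))
lemma2p17 h 5≤h with k , refl ← ℕ.m≤n⇒∃[o]m+o≡n (ℕ.<⇒≤ 5≤h)
  with L , unique , inSumset , size ← Covers⇒distinct {T = tri (4 + k) + (5 + k)} (covers-setA k) =
  L , unique , inSumset , subst (_≤ length L) (interval-size (4 + k)) size
  where
  interval-size : ∀ h → suc ((tri h + suc h) + (tri h + suc h)) ≡ h * h + h + 3
  interval-size h = begin
    suc ((tri h + suc h) + (tri h + suc h)) ≡⟨ shuffle (tri h) h ⟩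
    (tri h + tri h + h) + h + 3             ≡⟨ cong (λ x → x + h + 3) (tri+tri+n≡n*n h) ⟩
    h * h + h + 3                           ∎
    where
    open ≡-Reasoning
    shuffle : ∀ t h → suc ((t + suc h) + (t + suc h)) ≡ (t + t + h) + h + 3
    shuffle = ℕ-Ring.solve-∀
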